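{- Let $j\ge1$ and let $a,b$ be integers with $\gcd(a,b)=1$. Let $n>1$ be an integer with $n^j\mid a^n-b^n$, and let $q$ be the largest prime factor of $n$. Then $(n/q)^j\mid a^{n/q}-b^{n/q}$. -}

module Defs where

open import Data.Nat using (ℕ; _≤_)
open import Data.Nat.Divisibility using (_∣_)
open import Data.Nat.Primality using (Prime)
open import Data.Product using (_×_)

IsLargestPrimeFactor : ℕ → ℕ → Set
IsLargestPrimeFactor q n = Prime q × (q ∣ n) × (∀ p → Prime p → p ∣ n → p ≤ q)

module Submission where

-- Put x = a ^ m, y = b ^ m and S = geom q x y = (x ^ q - y ^ q) / (x - y), so
-- that m ^ j q ^ j ∣ (x - y) S.  It suffices to remove from S everything that
-- shares a prime with m (lemma cancel-coprime), and the primes of m are ≤ q: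
--  * a prime p < q never divides S: otherwise x ^ q ≡ y ^ q mod p, and since
--    q is prime to p - 1, Fermat's little theorem gives x ≡ y mod p, so that
--    x S ≡ q x ^ q mod p, which p does not divide (small-prime∤geom);
--  * if q ∣ m, Fermat gives x ≡ y mod q, so q ∣ S but q ^ 2 ∤ S (lifting the
--    exponent, lemma lte; for q = 2 one uses that x, y are odd squares), and
--    the single factor q of S is absorbed by q ^ j as j ≥ 1.
-- The file develops, in this order: congruences modulo an integer, Fermat's
-- little theorem from the library's binomial theorem, injectivity of z ↦ z ^ e
-- modulo p, geometric sums and their expansions modulo (x - y) ^ 2, the two
-- facts above, cancellation of a cofactor coprime to m, and the descent
-- n = m q ↦ m (module Descent), from which Proposition 2 follows.

open import Defs
open import Data.Nat using (ℕ; _≤_; _<_; _/_; NonZero)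
open import Data.Integer using (ℤ; +_; _-_; _^_)
open import Data.Integer.Divisibility using (_∣_)
open import Data.Integer.GCD using (gcd)
open import Relation.Binary.PropositionalEquality using (_≡_)

open import Data.Nat as ℕ using (zero; suc; z≤n; s≤s; _!)
import Data.Nat.Properties as ℕP
import Data.Nat.Divisibility as ℕ
open import Data.Nat.Primality using (Prime; prime⇒nonZero; euclidsLemma; prime⇒nonTrivial; prime⇒irreducible; prime[2])
open import Data.Nat.Coprimality using (Coprime; coprime-Bézout; prime⇒coprime)
open import Data.Nat.GCD using (module Bézout)
open import Data.Nat.Primality.Factorisation using (factorise)
open import Data.Nat.ListAction using (product)
open import Data.Nat.Combinatorics using (_C_; nCn≡1; nCk≡n!/k![n-k]!; k![n∸k]!∣n!)
open import Data.Nat.DivMod using (m/n*n≡m; m*n/n≡m)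
open import Data.Integer as ℤ using (-[1+_]; 0ℤ; 1ℤ; ∣_∣; _+_; _*_; -_)
import Data.Integer.Properties as ℤP
open import Data.Integer.Divisibility.Signed using (divides; quotient; ∣-refl; ∣ᵤ⇒∣; ∣⇒∣ᵤ; ∣m∣n⇒∣m+n; ∣m⇒∣-m; ∣n⇒∣m*n; ∣m⇒∣m*n; ∣-trans; *-cancelʳ-∣)
  renaming (_∣_ to _∣ₛ_)
import Data.Integer.Coprimality as ℤ
open import Data.Integer.DivMod using (a≡a%ℕn+[a/ℕn]*n; n%ℕd<d; _%ℕ_; _/ℕ_)
open import Data.Integer.GCD using (gcd-greatest)
open import Data.Integer.Tactic.RingSolver using (solve-∀)
open import Data.Fin using (toℕ; fromℕ; inject₁) renaming (zero to fzero; suc to fsuc)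
import Data.Fin.Properties as FinP
open import Data.Vec.Functional using (Vector; tail; init; last)
open import Data.List using ([]; _∷_)
open import Data.List.Relation.Unary.All using (_∷_)
open import Data.Product using (∃-syntax; _×_; _,_; proj₁; proj₂)
open import Data.Sum using (_⊎_; inj₁; inj₂)
open import Data.Empty using (⊥; ⊥-elim)
open import Function using (_∘_)
open import Relation.Nullary using (¬_; Dec; yes; no)
open import Relation.Binary.PropositionalEquality using (_≢_; refl; sym; trans; cong; cong₂; subst; subst₂; module ≡-Reasoning)
open import Relation.Binary.Bundles using (Setoid)
import Relation.Binary.Reasoning.Setoid
import Algebra.Properties.CommutativeSemiring.Binomial ℤP.+-*-commutativeSemiring as Binomial
open import Algebra.Properties.Semiring.Mult ℤP.+-*-semiring using () renaming (_×_ to _×ℤ_)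
open import Algebra.Properties.Monoid.Sum ℤP.+-0-monoid using (sum; sum-init-last)
import Algebra.Properties.Semiring.Exp ℤP.+-*-semiring as Exp
import Algebra.Properties.CommutativeSemiring.Exp ℤP.+-*-commutativeSemiring as CExp

prime>1 : ∀ {p} → Prime p → 1 < p
prime>1 {p} pp = ℕ.nonTrivial⇒n>1 p {{prime⇒nonTrivial pp}}

prime∤1 : ∀ {p} → Prime p → ¬ (+ p ∣ₛ 1ℤ)
prime∤1 pp p∣1 with ℕ.∣1⇒≡1 (∣⇒∣ᵤ p∣1) | prime>1 pp
... | refl | s≤s ()

euclidℤ : ∀ {p x y} → Prime p → + p ∣ₛ x * y → (+ p ∣ₛ x) ⊎ (+ p ∣ₛ y)
euclidℤ {p} {x} {y} pp p∣xy with euclidsLemma ∣ x ∣ ∣ y ∣ pp (subst (p ℕ.∣_) (ℤP.abs-* x y) (∣⇒∣ᵤ p∣xy))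
... | inj₁ p∣x = inj₁ (∣ᵤ⇒∣ p∣x)
... | inj₂ p∣y = inj₂ (∣ᵤ⇒∣ p∣y)

prime∣^⇒∣ : ∀ {p x} → Prime p → ∀ k → + p ∣ₛ x ^ k → + p ∣ₛ x
prime∣^⇒∣ pp zero    p∣1 = ⊥-elim (prime∤1 pp p∣1)
prime∣^⇒∣ pp (suc k) p∣xxᵏ with euclidℤ pp p∣xxᵏ
... | inj₁ p∣x  = p∣x
... | inj₂ p∣xᵏ = prime∣^⇒∣ pp k p∣xᵏ

infix 4 _≡_mod_
record _≡_mod_ (x y m : ℤ) : Set where
  constructor congruent
  field ∣difference : m ∣ₛ x - y

module _ {m : ℤ} where

  mod-reflexive : ∀ {x y} → x ≡ y → x ≡ y mod m
  mod-reflexive {x} refl = congruent (divides 0ℤ (ℤP.+-inverseʳ x))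

  mod-refl : ∀ x → x ≡ x mod m
  mod-refl x = mod-reflexive refl

  mod-sym : ∀ {x y} → x ≡ y mod m → y ≡ x mod m
  mod-sym {x} {y} (congruent d) = congruent (subst (m ∣ₛ_) (lem x y) (∣m⇒∣-m d))
    where lem : ∀ x y → - (x - y) ≡ y - x
          lem = solve-∀

  mod-trans : ∀ {x y z} → x ≡ y mod m → y ≡ z mod m → x ≡ z mod m
  mod-trans {x} {y} {z} (congruent d) (congruent e) = congruent (subst (m ∣ₛ_) (lem x y z) (∣m∣n⇒∣m+n d e))
    where lem : ∀ x y z → (x - y) + (y - z) ≡ x - z
          lem = solve-∀

  mod-+ : ∀ {x x′ y y′} → x ≡ x′ mod m → y ≡ y′ mod m → x + y ≡ x′ + y′ mod m
  mod-+ {x} {x′} {y} {y′} (congruent d) (congruent e) = congruent (subst (m ∣ₛ_) (lem x x′ y y′) (∣m∣n⇒∣m+n d e))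
    where lem : ∀ x x′ y y′ → (x - x′) + (y - y′) ≡ (x + y) - (x′ + y′)
          lem = solve-∀

  mod-* : ∀ {x x′ y y′} → x ≡ x′ mod m → y ≡ y′ mod m → x * y ≡ x′ * y′ mod m
  mod-* {x} {x′} {y} {y′} (congruent d) (congruent e) =
    congruent (subst (m ∣ₛ_) (lem x x′ y y′) (∣m∣n⇒∣m+n (∣m⇒∣m*n y d) (∣n⇒∣m*n x′ e)))
    where lem : ∀ x x′ y y′ → (x - x′) * y + x′ * (y - y′) ≡ x * y - x′ * y′
          lem = solve-∀

  mod-neg : ∀ {x y} → x ≡ y mod m → - x ≡ - y mod m
  mod-neg {x} {y} (congruent d) = congruent (subst (m ∣ₛ_) (lem x y) (∣m⇒∣-m d))
    where lem : ∀ x y → - (x - y) ≡ - x - - y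
          lem = solve-∀

  mod-^ : ∀ {x x′} n → x ≡ x′ mod m → x ^ n ≡ x′ ^ n mod m
  mod-^ zero    d = mod-refl 1ℤ
  mod-^ (suc n) d = mod-* d (mod-^ n d)

  mod-∣ : ∀ {x y} → x ≡ y mod m → m ∣ₛ x → m ∣ₛ y
  mod-∣ {x} {y} (congruent d) m∣x = subst (m ∣ₛ_) (lem x y) (∣m∣n⇒∣m+n m∣x (∣m⇒∣-m d))
    where lem : ∀ x y → x + - (x - y) ≡ y
          lem = solve-∀

  ∣⇒≡0 : ∀ {x} → m ∣ₛ x → x ≡ 0ℤ mod m
  ∣⇒≡0 {x} m∣x = congruent (subst (m ∣ₛ_) (sym (ℤP.+-identityʳ x)) m∣x)

  multiple≡0 : ∀ c → c * m ≡ 0ℤ mod m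
  multiple≡0 c = ∣⇒≡0 (divides c refl)

  ≡0⇒∣ : ∀ {x} → x ≡ 0ℤ mod m → m ∣ₛ x
  ≡0⇒∣ x≡0 = mod-∣ (mod-sym x≡0) (divides 0ℤ refl)

  mod-setoid : Setoid _ _
  mod-setoid = record
    { Carrier       = ℤ
    ; _≈_           = _≡_mod m
    ; isEquivalence = record { refl = mod-refl _ ; sym = mod-sym ; trans = mod-trans }
    }

mod-weaken : ∀ {m n x y} → n ∣ₛ m → x ≡ y mod m → x ≡ y mod n
mod-weaken n∣m (congruent d) = congruent (∣-trans n∣m d)

module ModReasoning (m : ℤ) = Relation.Binary.Reasoning.Setoid (mod-setoid {m})

mod-cancelˡ : ∀ {p z x y} → Prime p → ¬ (+ p ∣ₛ z) → z * x ≡ z * y mod + p → x ≡ y mod + p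
mod-cancelˡ {p} {z} {x} {y} pp p∤z (congruent d) with euclidℤ pp (subst (+ p ∣ₛ_) (lem z x y) d)
  where lem : ∀ z x y → z * x - z * y ≡ z * (x - y)
        lem = solve-∀
... | inj₁ p∣z   = ⊥-elim (p∤z p∣z)
... | inj₂ p∣x-y = congruent p∣x-y

prime∤! : ∀ {p} → Prime p → ∀ m → m < p → ¬ (p ℕ.∣ m !)
prime∤! pp zero    _   p∣1 = prime∤1 pp (∣ᵤ⇒∣ p∣1)
prime∤! pp (suc m) m<p p∣m! with euclidsLemma (suc m) (m !) pp p∣m!
... | inj₁ p∣1+m = ℕP.<⇒≱ m<p (ℕ.∣⇒≤ p∣1+m)
... | inj₂ p∣m!′ = prime∤! pp m (ℕP.<-trans (ℕP.n<1+n m) m<p) p∣m!′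

prime∣C : ∀ {p k} → Prime p → 0 < k → k < p → p ℕ.∣ p C k
prime∣C {suc p′} {k} pp 0<k k<p with euclidsLemma (suc p′ C k) (k ! ℕ.* (suc p′ ℕ.∸ k) !) pp p∣p!
  where
  instance _ = ℕP._!*_!≢0 k (suc p′ ℕ.∸ k)
  k≤p = ℕP.<⇒≤ k<p
  -- (p C k) · (k! · (p - k)!) = p! = p · (p - 1)!
  p∣p! : suc p′ ℕ.∣ (suc p′ C k) ℕ.* (k ! ℕ.* (suc p′ ℕ.∸ k) !)
  p∣p! = subst (suc p′ ℕ.∣_)
    (sym (trans (cong (ℕ._* (k ! ℕ.* (suc p′ ℕ.∸ k) !)) (nCk≡n!/k![n-k]! k≤p)) (m/n*n≡m (k![n∸k]!∣n! k≤p))))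
    (ℕ.m∣m*n (p′ !))
... | inj₁ p∣C = p∣C
... | inj₂ p∣k![p-k]! with euclidsLemma (k !) ((suc p′ ℕ.∸ k) !) pp p∣k![p-k]!
...   | inj₁ p∣k!     = ⊥-elim (prime∤! pp k k<p p∣k!)
...   | inj₂ p∣[p-k]! = ⊥-elim (prime∤! pp (suc p′ ℕ.∸ k) (ℕP.∸-monoʳ-< 0<k (ℕP.<⇒≤ k<p)) p∣[p-k]!)

-- The library's binomial theorem is phrased with the semiring's iterated
-- addition n × x and power x ^ n; on ℤ these are + n * x and ℤ._^_.
×≡* : ∀ n x → n ×ℤ x ≡ + n * x
×≡* zero    x = sym (ℤP.*-zeroˡ x)
×≡* (suc n) x = trans (cong (_+_ x) (×≡* n x)) (lem x (+ n))
  where lem : ∀ x n → x + n * x ≡ (1ℤ + n) * x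
        lem = solve-∀

^≡^ : ∀ x n → x Exp.^ n ≡ x ^ n
^≡^ x zero    = refl
^≡^ x (suc n) = cong (x *_) (^≡^ x n)

^-distrib-* : ∀ x y n → (x * y) ^ n ≡ x ^ n * y ^ n
^-distrib-* x y n = begin
  (x * y) ^ n              ≡⟨ sym (^≡^ (x * y) n) ⟩
  (x * y) Exp.^ n          ≡⟨ CExp.^-distrib-* x y n ⟩
  x Exp.^ n * y Exp.^ n    ≡⟨ cong₂ _*_ (^≡^ x n) (^≡^ y n) ⟩
  x ^ n * y ^ n            ∎
  where open ≡-Reasoning

binomialTerm≡ : ∀ x y n k →
  Binomial.binomialTerm x y n k ≡ + (n C toℕ k) * (x ^ toℕ k * y ^ (n ℕ.∸ toℕ k))
binomialTerm≡ x y n k = trans (×≡* (n C toℕ k) _)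
  (cong (+ (n C toℕ k) *_) (cong₂ _*_ (^≡^ x (toℕ k)) (^≡^ y (n ℕ.∸ toℕ k))))

∣-sum : ∀ {d n} (t : Vector ℤ n) → (∀ i → d ∣ₛ t i) → d ∣ₛ sum t
∣-sum {n = zero}  t d∣t = divides 0ℤ refl
∣-sum {n = suc n} t d∣t = ∣m∣n⇒∣m+n (d∣t fzero) (∣-sum (tail t) (d∣t ∘ fsuc))

-- The terms of the binomial expansion of (x + y) ^ (1 + n) strictly between
-- the two extreme terms y ^ (1 + n) and x ^ (1 + n).
innerTerms : ℤ → ℤ → (n : ℕ) → Vector ℤ n
innerTerms x y n i = Binomial.binomialTerm x y (suc n) (fsuc (inject₁ i))

binomial-extremes : ∀ x y n → (x + y) ^ suc n ≡ y ^ suc n + (sum (innerTerms x y n) + x ^ suc n)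
binomial-extremes x y n = begin
  (x + y) ^ p                                     ≡⟨ sym (^≡^ (x + y) p) ⟩
  (x + y) Exp.^ p                                 ≡⟨ Binomial.theorem p x y ⟩
  t fzero + sum (tail t)                          ≡⟨ cong (_+_ (t fzero)) (sum-init-last (tail t)) ⟩
  t fzero + (sum (init (tail t)) + last (tail t)) ≡⟨ cong₂ (λ a b → a + (sum (init (tail t)) + b)) first final ⟩
  y ^ p + (sum (innerTerms x y n) + x ^ p)        ∎
  where
  open ≡-Reasoning
  p = suc n
  t : Vector ℤ (suc p)
  t = Binomial.binomialTerm x y p
  first : t fzero ≡ y ^ p
  first = trans (binomialTerm≡ x y p fzero) (lem (y ^ p))
    where lem : ∀ Y → + 1 * (1ℤ * Y) ≡ Y
          lem = solve-∀
  final : last (tail t) ≡ x ^ p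
  final = begin
    last (tail t)                        ≡⟨ binomialTerm≡ x y p (fsuc (fromℕ n)) ⟩
    term (suc (toℕ (fromℕ n)))           ≡⟨ cong (term ∘ suc) (FinP.toℕ-fromℕ n) ⟩
    + (p C p) * (x ^ p * y ^ (p ℕ.∸ p))  ≡⟨ cong₂ (λ c e → + c * (x ^ p * y ^ e)) (nCn≡1 p) (ℕP.n∸n≡0 p) ⟩
    + 1 * (x ^ p * 1ℤ)                   ≡⟨ lem (x ^ p) ⟩
    x ^ p                                ∎
    where term : ℕ → ℤ
          term k = + (p C k) * (x ^ k * y ^ (p ℕ.∸ k))
          lem : ∀ X → + 1 * (X * 1ℤ) ≡ X
          lem = solve-∀

freshman : ∀ {p} → Prime p → ∀ x y → (x + y) ^ p ≡ x ^ p + y ^ p mod + p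
freshman {suc n} pp x y = begin
  (x + y) ^ p                               ≡⟨ binomial-extremes x y n ⟩
  y ^ p + (sum (innerTerms x y n) + x ^ p)  ≈⟨ mod-+ (mod-refl (y ^ p)) (mod-+ (∣⇒≡0 inner) (mod-refl (x ^ p))) ⟩
  y ^ p + (0ℤ + x ^ p)                      ≡⟨ lem (x ^ p) (y ^ p) ⟩
  x ^ p + y ^ p                             ∎
  where
  open ModReasoning (+ suc n)
  p = suc n
  lem : ∀ X Y → Y + (0ℤ + X) ≡ X + Y
  lem = solve-∀
  p∣multiple : ∀ {k} z → suc k < p → + p ∣ₛ + (p C suc k) * z
  p∣multiple {k} z k<p = ∣m⇒∣m*n {m = + (p C suc k)} z (∣ᵤ⇒∣ {+ p} {+ (p C suc k)} (prime∣C pp (s≤s z≤n) k<p))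
  inner : + p ∣ₛ sum (innerTerms x y n)
  inner = ∣-sum (innerTerms x y n) λ i →
    subst (+ p ∣ₛ_) (sym (binomialTerm≡ x y p (fsuc (inject₁ i))))
      (p∣multiple _ (s≤s (subst (ℕ._< n) (sym (FinP.toℕ-inject₁ i)) (FinP.toℕ<n i))))

fermat : ∀ {p} → Prime p → ∀ z → z ^ p ≡ z mod + p
fermat {p@(suc p′)} pp = by-sign
  where
  open ModReasoning (+ p)
  fermat-ℕ : ∀ n → (+ n) ^ p ≡ + n mod + p
  fermat-ℕ zero    = mod-reflexive (ℤP.*-zeroˡ (0ℤ ^ p′))
  fermat-ℕ (suc n) = begin
    (1ℤ + + n) ^ p       ≈⟨ freshman pp 1ℤ (+ n) ⟩
    1ℤ ^ p + (+ n) ^ p   ≈⟨ mod-+ (mod-reflexive (ℤP.^-zeroˡ p)) (fermat-ℕ n) ⟩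
    1ℤ + + n             ∎
  -- A negative z = - w satisfies 0 = (z + w) ^ p ≡ z ^ p + w ^ p and w ^ p ≡ w.
  by-sign : ∀ z → z ^ p ≡ z mod + p
  by-sign (+ n)    = fermat-ℕ n
  by-sign -[1+ n ] = begin
    z ^ p                   ≡⟨ lem (z ^ p) (w ^ p) ⟩
    (z ^ p + w ^ p) - w ^ p ≈⟨ mod-+ (mod-sym (freshman pp z w)) (mod-reflexive refl) ⟩
    (z + w) ^ p - w ^ p     ≡⟨ cong (λ u → u ^ p - w ^ p) (ℤP.+-inverseˡ w) ⟩
    0ℤ ^ p - w ^ p          ≈⟨ mod-+ (fermat-ℕ 0) (mod-neg (fermat-ℕ (suc n))) ⟩
    0ℤ - w                  ≡⟨ ℤP.+-identityˡ z ⟩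
    z                       ∎
    where
    w = + suc n
    z = - w
    lem : ∀ a b → a ≡ (a + b) - b
    lem = solve-∀

fermat-iterated : ∀ {p} → Prime p → ∀ t z → z ^ (1 ℕ.+ t ℕ.* (p ℕ.∸ 1)) ≡ z mod + p
fermat-iterated {p@(suc p′)} pp zero    z = mod-reflexive (ℤP.*-identityʳ z)
fermat-iterated {p@(suc p′)} pp (suc t) z = begin
  z ^ suc (p′ ℕ.+ t ℕ.* p′)       ≡⟨ cong (z ^_) (sym (ℕP.+-suc p′ (t ℕ.* p′))) ⟩
  z ^ (p′ ℕ.+ suc (t ℕ.* p′))     ≡⟨ ℤP.^-distribˡ-+-* z p′ (suc (t ℕ.* p′)) ⟩
  z ^ p′ * z ^ suc (t ℕ.* p′)     ≈⟨ mod-* (mod-refl (z ^ p′)) (fermat-iterated pp t z) ⟩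
  z ^ p′ * z                      ≡⟨ ℤP.*-comm (z ^ p′) z ⟩
  z ^ p                           ≈⟨ fermat pp z ⟩
  z                               ∎
  where open ModReasoning (+ p)

fermat-unit : ∀ {p z} → Prime p → ¬ (+ p ∣ₛ z) → ∀ t → z ^ (t ℕ.* (p ℕ.∸ 1)) ≡ 1ℤ mod + p
fermat-unit {p} {z} pp p∤z t = mod-cancelˡ pp p∤z (begin
  z ^ (1 ℕ.+ t ℕ.* (p ℕ.∸ 1))  ≈⟨ fermat-iterated pp t z ⟩
  z                            ≡⟨ sym (ℤP.*-identityʳ z) ⟩
  z * 1ℤ                       ∎)
  where open ModReasoning (+ p)

pow-injective : ∀ {p e X Y} → Prime p → Coprime e (p ℕ.∸ 1) → ¬ (+ p ∣ₛ X) → ¬ (+ p ∣ₛ Y) →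
                X ^ e ≡ Y ^ e mod + p → X ≡ Y mod + p
pow-injective {p} {e} {X} {Y} pp e⊥p-1 p∤X p∤Y Xᵉ≡Yᵉ with coprime-Bézout e⊥p-1
... | Bézout.+- u t 1+t[p-1]≡ue = begin
  X                        ≈⟨ mod-sym (fermat-iterated pp t X) ⟩
  X ^ (1 ℕ.+ t ℕ.* (p ℕ.∸ 1)) ≡⟨ as-power X ⟩
  (X ^ e) ^ u              ≈⟨ mod-^ u Xᵉ≡Yᵉ ⟩
  (Y ^ e) ^ u              ≡⟨ sym (as-power Y) ⟩
  Y ^ (1 ℕ.+ t ℕ.* (p ℕ.∸ 1)) ≈⟨ fermat-iterated pp t Y ⟩
  Y                        ∎
  where
  open ModReasoning (+ p)
  as-power : ∀ Z → Z ^ (1 ℕ.+ t ℕ.* (p ℕ.∸ 1)) ≡ (Z ^ e) ^ u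
  as-power Z = trans (cong (Z ^_) (trans 1+t[p-1]≡ue (ℕP.*-comm u e))) (sym (ℤP.^-*-assoc Z e u))
... | Bézout.-+ u t 1+ue≡t[p-1] = mod-cancelˡ pp p∤W (begin
  W * X    ≡⟨ ℤP.*-comm W X ⟩
  X * W    ≈⟨ inverse X p∤X ⟩
  1ℤ       ≈⟨ mod-sym (inverse Y p∤Y) ⟩
  Y * V    ≈⟨ mod-* (mod-refl Y) (mod-sym (mod-^ u Xᵉ≡Yᵉ)) ⟩
  Y * W    ≡⟨ ℤP.*-comm Y W ⟩
  W * Y    ∎)
  where
  open ModReasoning (+ p)
  W = (X ^ e) ^ u
  V = (Y ^ e) ^ u
  -- (Z ^ e) ^ u is an inverse of Z modulo p: Z (Z ^ e) ^ u = Z ^ (t (p - 1)) ≡ 1.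
  inverse : ∀ Z → ¬ (+ p ∣ₛ Z) → Z * (Z ^ e) ^ u ≡ 1ℤ mod + p
  inverse Z p∤Z = begin
    Z * (Z ^ e) ^ u       ≡⟨ cong (Z *_) (ℤP.^-*-assoc Z e u) ⟩
    Z ^ suc (e ℕ.* u)     ≡⟨ cong (λ k → Z ^ suc k) (ℕP.*-comm e u) ⟩
    Z ^ suc (u ℕ.* e)     ≡⟨ cong (Z ^_) 1+ue≡t[p-1] ⟩
    Z ^ (t ℕ.* (p ℕ.∸ 1)) ≈⟨ fermat-unit pp p∤Z t ⟩
    1ℤ                    ∎
  p∤W : ¬ (+ p ∣ₛ W)
  p∤W p∣W = prime∤1 pp (mod-∣ (inverse X p∤X) (∣n⇒∣m*n X p∣W))

geom : ℕ → ℤ → ℤ → ℤ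
geom zero    x y = 0ℤ
geom (suc k) x y = x ^ k + y * geom k x y

geom-factor : ∀ k x y → x ^ k - y ^ k ≡ (x - y) * geom k x y
geom-factor zero    x y = sym (ℤP.*-zeroʳ (x - y))
geom-factor (suc k) x y = begin
  x * x ^ k - y * y ^ k                 ≡⟨ lem₁ x y (x ^ k) (y ^ k) ⟩
  (x - y) * x ^ k + y * (x ^ k - y ^ k) ≡⟨ cong (λ d → (x - y) * x ^ k + y * d) (geom-factor k x y) ⟩
  (x - y) * x ^ k + y * ((x - y) * geom k x y) ≡⟨ lem₂ x y (x ^ k) (geom k x y) ⟩
  (x - y) * geom (suc k) x y            ∎
  where
  open ≡-Reasoning
  lem₁ : ∀ x y X Y → x * X - y * Y ≡ (x - y) * X + y * (X - Y)
  lem₁ = solve-∀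
  lem₂ : ∀ x y X g → (x - y) * X + y * ((x - y) * g) ≡ (x - y) * (X + y * g)
  lem₂ = solve-∀

geom-cong : ∀ {m x x′ y y′} k → x ≡ x′ mod m → y ≡ y′ mod m → geom k x y ≡ geom k x′ y′ mod m
geom-cong zero    x≡x′ y≡y′ = mod-refl 0ℤ
geom-cong (suc k) x≡x′ y≡y′ = mod-+ (mod-^ k x≡x′) (mod-* y≡y′ (geom-cong k x≡x′ y≡y′))

geom-diagonal : ∀ k x → x * geom k x x ≡ + k * x ^ k
geom-diagonal zero    x = trans (ℤP.*-zeroʳ x) (sym (ℤP.*-zeroˡ 1ℤ))
geom-diagonal (suc k) x = begin
  x * (x ^ k + x * geom k x x)   ≡⟨ ℤP.*-distribˡ-+ x (x ^ k) (x * geom k x x) ⟩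
  x * x ^ k + x * (x * geom k x x) ≡⟨ cong (λ g → x * x ^ k + x * g) (geom-diagonal k x) ⟩
  x * x ^ k + x * (+ k * x ^ k)  ≡⟨ lem x (x ^ k) (+ k) ⟩
  (1ℤ + + k) * (x * x ^ k)       ∎
  where
  open ≡-Reasoning
  lem : ∀ x X K → x * X + x * (K * X) ≡ (1ℤ + K) * (x * X)
  lem = solve-∀

geom≡diagonal : ∀ {m x y} k → x ≡ y mod m → x * geom k x y ≡ + k * x ^ k mod m
geom≡diagonal {m} {x} {y} k x≡y = begin
  x * geom k x y  ≈⟨ mod-* (mod-refl x) (geom-cong k (mod-refl x) (mod-sym x≡y)) ⟩
  x * geom k x x  ≡⟨ geom-diagonal k x ⟩
  + k * x ^ k     ∎
  where open ModReasoning m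

NoCommonPrime : ℤ → ℤ → Set
NoCommonPrime x y = ∀ {p} → Prime p → + p ∣ₛ x → + p ∣ₛ y → ⊥

NoCommonPrime-^ : ∀ {x y} → NoCommonPrime x y → ∀ k → NoCommonPrime (x ^ k) (y ^ k)
NoCommonPrime-^ x⊥y k pp p∣xᵏ p∣yᵏ = x⊥y pp (prime∣^⇒∣ pp k p∣xᵏ) (prime∣^⇒∣ pp k p∣yᵏ)

congruent⇒∤ : ∀ {p x y} → NoCommonPrime x y → Prime p → x ≡ y mod + p →
              ¬ (+ p ∣ₛ x) × ¬ (+ p ∣ₛ y)
congruent⇒∤ x⊥y pp x≡y = (λ p∣x → x⊥y pp p∣x (mod-∣ x≡y p∣x))
                       , (λ p∣y → x⊥y pp (mod-∣ (mod-sym x≡y) p∣y) p∣y)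

-- For primes p < q, the prime q is coprime to p - 1 (as p - 1 < q).
coprime-pred : ∀ {p q} → Prime p → Prime q → p < q → Coprime q (p ℕ.∸ 1)
coprime-pred {p} pp qp p<q with prime>1 pp
... | s≤s (s≤s _) = prime⇒coprime qp (ℕP.<-trans (ℕP.n<1+n _) p<q)

-- The heart of the argument for primes p < q: if p ∣ geom q x y then
-- x ^ q ≡ y ^ q mod p, hence x ≡ y mod p (as q is prime to p - 1), hence
-- x geom q x y ≡ q x ^ q mod p, which p cannot divide.
small-prime∤geom : ∀ {p q x y} → Prime p → Prime q → p < q → NoCommonPrime x y →
                   ¬ (+ p ∣ₛ geom q x y)
small-prime∤geom {p} {suc q′} {x} {y} pp qp p<q@(s≤s _) x⊥y p∣S = by-euclid (euclidℤ pp p∣qxᵠ)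
  where
  q = suc q′
  xᵠ≡yᵠ : x ^ q ≡ y ^ q mod + p
  xᵠ≡yᵠ = congruent (subst (+ p ∣ₛ_) (sym (geom-factor q x y)) (∣n⇒∣m*n (x - y) p∣S))
  p∤xᵠ,yᵠ = congruent⇒∤ (NoCommonPrime-^ x⊥y q) pp xᵠ≡yᵠ
  p∤x : ¬ (+ p ∣ₛ x)
  p∤x p∣x = proj₁ p∤xᵠ,yᵠ (∣m⇒∣m*n (x ^ q′) p∣x)
  p∤y : ¬ (+ p ∣ₛ y)
  p∤y p∣y = proj₂ p∤xᵠ,yᵠ (∣m⇒∣m*n (y ^ q′) p∣y)
  x≡y : x ≡ y mod + p
  x≡y = pow-injective pp (coprime-pred pp qp p<q) p∤x p∤y xᵠ≡yᵠ
  p∣qxᵠ : + p ∣ₛ + q * x ^ q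
  p∣qxᵠ = mod-∣ (geom≡diagonal q x≡y) (∣n⇒∣m*n x p∣S)
  by-euclid : (+ p ∣ₛ + q) ⊎ (+ p ∣ₛ x ^ q) → ⊥
  by-euclid (inj₁ p∣q) with prime⇒irreducible qp (∣⇒∣ᵤ p∣q)
  ... | inj₁ refl = ℕP.<-irrefl refl (prime>1 pp)
  ... | inj₂ refl = ℕP.<-irrefl refl p<q
  by-euclid (inj₂ p∣xᵠ) = p∤x (prime∣^⇒∣ pp q p∣xᵠ)

-- If x ≡ y modulo a prime q not dividing x, then q ∣ geom q x y,
-- since x geom q x y ≡ q x ^ q ≡ 0 modulo q.
prime∣geom : ∀ {q x y} → Prime q → ¬ (+ q ∣ₛ x) → x ≡ y mod + q → + q ∣ₛ geom q x y
prime∣geom {q} {x} {y} qp q∤x x≡y with euclidℤ qp q∣xS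
  where
  q∣xS : + q ∣ₛ x * geom q x y
  q∣xS = mod-∣ (mod-sym (geom≡diagonal q x≡y)) (∣m⇒∣m*n (x ^ q) (divides 1ℤ (sym (ℤP.*-identityˡ (+ q)))))
... | inj₁ q∣x = ⊥-elim (q∤x q∣x)
... | inj₂ q∣S = q∣S

-- First-order expansion of x ^ k around y, modulo (x - y) ^ 2
-- (multiplied by y to avoid the exponent k - 1).
pow-expand : ∀ k x y → y * x ^ k ≡ y ^ suc k + + k * y ^ k * (x - y) mod (x - y) * (x - y)
pow-expand zero    x y = mod-reflexive (lem x y)
  where lem : ∀ x y → y * 1ℤ ≡ y * 1ℤ + + 0 * 1ℤ * (x - y)
        lem = solve-∀
pow-expand (suc k) x y = begin
  y * (x * x ^ k)                                      ≡⟨ lem₁ x y (x ^ k) ⟩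
  x * (y * x ^ k)                                      ≈⟨ mod-* (mod-refl x) (pow-expand k x y) ⟩
  x * (y * y ^ k + + k * y ^ k * (x - y))              ≡⟨ lem₂ x y (y ^ k) (+ k) ⟩
  y ^ suc (suc k) + + suc k * y ^ suc k * (x - y) + + k * y ^ k * ((x - y) * (x - y))
                                                       ≈⟨ mod-+ (mod-refl (y ^ suc (suc k) + + suc k * y ^ suc k * (x - y))) (multiple≡0 (+ k * y ^ k)) ⟩
  y ^ suc (suc k) + + suc k * y ^ suc k * (x - y) + 0ℤ ≡⟨ ℤP.+-identityʳ _ ⟩
  y ^ suc (suc k) + + suc k * y ^ suc k * (x - y)      ∎
  where
  open ModReasoning ((x - y) * (x - y))
  lem₁ : ∀ x y X → y * (x * X) ≡ x * (y * X)
  lem₁ = solve-∀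
  lem₂ : ∀ x y Y K → x * (y * Y + K * Y * (x - y)) ≡
         y * (y * Y) + (1ℤ + K) * (y * Y) * (x - y) + K * Y * ((x - y) * (x - y))
  lem₂ = solve-∀

geom-expand : ∀ k x y → + 2 * y * geom (suc k) x y ≡
              + 2 * + suc k * y ^ suc k + + suc k * + k * y ^ k * (x - y) mod (x - y) * (x - y)
geom-expand zero    x y = mod-reflexive (lem x y)
  where lem : ∀ x y → + 2 * y * (1ℤ + y * 0ℤ) ≡ + 2 * + 1 * (y * 1ℤ) + + 1 * + 0 * 1ℤ * (x - y)
        lem = solve-∀
geom-expand (suc k) x y = begin
  + 2 * y * (x ^ suc k + y * geom (suc k) x y)               ≡⟨ lem₁ y (x ^ suc k) (geom (suc k) x y) ⟩
  + 2 * (y * x ^ suc k) + y * (+ 2 * y * geom (suc k) x y)   ≈⟨ mod-+ (mod-* (mod-refl (+ 2)) (pow-expand (suc k) x y))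
                                                                      (mod-* (mod-refl y) (geom-expand k x y)) ⟩
  + 2 * (y ^ suc (suc k) + + suc k * y ^ suc k * (x - y)) +
    y * (+ 2 * + suc k * y ^ suc k + + suc k * + k * y ^ k * (x - y)) ≡⟨ lem₂ y (y ^ k) (+ k) (x - y) ⟩
  + 2 * + suc (suc k) * y ^ suc (suc k) + + suc (suc k) * + suc k * y ^ suc k * (x - y) ∎
  where
  open ModReasoning ((x - y) * (x - y))
  lem₁ : ∀ y X g → + 2 * y * (X + y * g) ≡ + 2 * (y * X) + y * (+ 2 * y * g)
  lem₁ = solve-∀
  lem₂ : ∀ y Y K d →
    + 2 * (y * (y * Y) + (1ℤ + K) * (y * Y) * d) + y * (+ 2 * (1ℤ + K) * (y * Y) + (1ℤ + K) * K * Y * d) ≡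
    + 2 * (1ℤ + (1ℤ + K)) * (y * (y * Y)) + (1ℤ + (1ℤ + K)) * (1ℤ + K) * (y * Y) * d
  lem₂ = solve-∀

-- Lifting the exponent for an odd prime q: if q ∣ x - y but q ∤ y, then
-- q ^ 2 ∤ geom q x y.  Modulo q ^ 2 the expansion above reads
-- 2 y geom q x y ≡ 2 q y ^ q, and q ^ 2 ∤ 2 q y ^ q.
lte-odd : ∀ {q x y} → Prime q → 2 < q → ¬ (+ q ∣ₛ y) → x ≡ y mod + q → ¬ (+ q * + q ∣ₛ geom q x y)
lte-odd {suc k} {x} {y} qp 2<q q∤y (congruent (divides c x-y≡cq)) q²∣S = by-euclid (euclidℤ {x = + 2} {y = y ^ suc k} qp q∣2yᵠ)
  where
  Q = + suc k
  q²∣d² : Q * Q ∣ₛ (x - y) * (x - y)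
  q²∣d² = divides (c * c) (trans (cong₂ _*_ x-y≡cq x-y≡cq) (lem c Q))
    where lem : ∀ c Q → c * Q * (c * Q) ≡ c * c * (Q * Q)
          lem = solve-∀
  first-order-term≡0 : Q * + k * y ^ k * (x - y) ≡ 0ℤ mod Q * Q
  first-order-term≡0 = ∣⇒≡0 (divides (+ k * y ^ k * c) (trans (cong (Q * + k * y ^ k *_) x-y≡cq) (lem Q (+ k) (y ^ k) c)))
    where lem : ∀ Q K Y c → Q * K * Y * (c * Q) ≡ K * Y * c * (Q * Q)
          lem = solve-∀
  2qyᵠ≡0 : + 2 * Q * y ^ suc k ≡ 0ℤ mod Q * Q
  2qyᵠ≡0 = begin
    + 2 * Q * y ^ suc k                                   ≡⟨ sym (ℤP.+-identityʳ _) ⟩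
    + 2 * Q * y ^ suc k + 0ℤ                              ≈⟨ mod-+ (mod-refl (+ 2 * Q * y ^ suc k)) (mod-sym first-order-term≡0) ⟩
    + 2 * Q * y ^ suc k + Q * + k * y ^ k * (x - y)       ≈⟨ mod-sym (mod-weaken q²∣d² (geom-expand k x y)) ⟩
    + 2 * y * geom (suc k) x y                            ≈⟨ ∣⇒≡0 (∣n⇒∣m*n (+ 2 * y) q²∣S) ⟩
    0ℤ                                                    ∎
    where open ModReasoning (Q * Q)
  q∣2yᵠ : Q ∣ₛ + 2 * y ^ suc k
  q∣2yᵠ = *-cancelʳ-∣ Q (subst (Q * Q ∣ₛ_) (lem Q (y ^ suc k)) (≡0⇒∣ 2qyᵠ≡0))
    where lem : ∀ Q Y → + 2 * Q * Y ≡ + 2 * Y * Q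
          lem = solve-∀
  by-euclid : (Q ∣ₛ + 2) ⊎ (Q ∣ₛ y ^ suc k) → ⊥
  by-euclid (inj₁ q∣2)  = ℕP.<⇒≱ 2<q (ℕ.∣⇒≤ (∣⇒∣ᵤ q∣2))
  by-euclid (inj₂ q∣yᵠ) = q∤y (prime∣^⇒∣ qp (suc k) q∣yᵠ)

odd-square : ∀ {u} → ¬ (+ 2 ∣ₛ u) → u ^ 2 ≡ 1ℤ mod + 4
odd-square {u} 2∤u = by-remainder (u %ℕ 2) (n%ℕd<d u 2) (a≡a%ℕn+[a/ℕn]*n u 2)
  where
  w = u /ℕ 2
  by-remainder : ∀ r → r < 2 → u ≡ + r + w * + 2 → u ^ 2 ≡ 1ℤ mod + 4
  by-remainder 0 _ u≡2w = ⊥-elim (2∤u (divides w (trans u≡2w (ℤP.+-identityˡ _))))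
  by-remainder 1 _ u≡1+2w = congruent (divides (w * w + w) (trans (cong (λ t → t ^ 2 - 1ℤ) u≡1+2w) (lem w)))
    where lem : ∀ w → (+ 1 + w * + 2) * ((+ 1 + w * + 2) * 1ℤ) - 1ℤ ≡ (w * w + w) * + 4
          lem = solve-∀
  by-remainder (suc (suc r)) (s≤s (s≤s ())) _

-- Lifting the exponent for q = 2 needs squares: for odd u and v,
-- u ^ 2 + v ^ 2 ≡ 2 modulo 4.
lte-two : ∀ {u v} → ¬ (+ 2 ∣ₛ u) → ¬ (+ 2 ∣ₛ v) → ¬ (+ 2 * + 2 ∣ₛ geom 2 (u ^ 2) (v ^ 2))
lte-two 2∤u 2∤v 4∣S = ℕP.<⇒≱ (s≤s (s≤s (s≤s z≤n))) (ℕ.∣⇒≤ (∣⇒∣ᵤ (mod-∣ (geom-cong 2 (odd-square 2∤u) (odd-square 2∤v)) 4∣S)))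

-- The case q = 2 of the next lemma: a ^ (2h) and b ^ (2h) are the squares of
-- u = a ^ h and v = b ^ h, which are odd when a ^ (2h) ≡ b ^ (2h) is coprime.
lte-two-powers : ∀ {a b} h → NoCommonPrime (a ^ (h ℕ.* 2)) (b ^ (h ℕ.* 2)) →
                 a ^ (h ℕ.* 2) ≡ b ^ (h ℕ.* 2) mod + 2 →
                 ¬ (+ 2 * + 2 ∣ₛ geom 2 (a ^ (h ℕ.* 2)) (b ^ (h ℕ.* 2)))
lte-two-powers {a} {b} h x⊥y x≡y 4∣S =
  lte-two 2∤u 2∤v (subst (λ t → + 2 * + 2 ∣ₛ t) (cong₂ (geom 2) (sym u²≡x) (sym v²≡y)) 4∣S)
  where
  u²≡x = ℤP.^-*-assoc a h 2
  v²≡y = ℤP.^-*-assoc b h 2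
  2∤x,y = congruent⇒∤ x⊥y prime[2] x≡y
  2∤u : ¬ (+ 2 ∣ₛ a ^ h)
  2∤u 2∣u = proj₁ 2∤x,y (subst (+ 2 ∣ₛ_) u²≡x (∣m⇒∣m*n (a ^ h * 1ℤ) 2∣u))
  2∤v : ¬ (+ 2 ∣ₛ b ^ h)
  2∤v 2∣v = proj₂ 2∤x,y (subst (+ 2 ∣ₛ_) v²≡y (∣m⇒∣m*n (b ^ h * 1ℤ) 2∣v))

lte : ∀ {q m a b} → Prime q → q ℕ.∣ m → NoCommonPrime (a ^ m) (b ^ m) → a ^ m ≡ b ^ m mod + q →
      ¬ (+ q * + q ∣ₛ geom q (a ^ m) (b ^ m))
lte {q} qp q∣m x⊥y x≡y with 2 ℕ.<? q
... | yes 2<q = lte-odd qp 2<q (proj₂ (congruent⇒∤ x⊥y qp x≡y)) x≡y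
... | no  2≮q with ℕP.≤-antisym (ℕP.≮⇒≥ 2≮q) (prime>1 qp) | q∣m
...   | refl | ℕ.divides h refl = lte-two-powers h x⊥y x≡y

prime-divisor : ∀ {d} → d ≢ 0 → d ≢ 1 → ∃[ p ] Prime p × p ℕ.∣ d
prime-divisor {d} d≢0 d≢1 with factorise d {{ℕ.≢-nonZero d≢0}}
... | record { factors = [] ; isFactorisation = d≡1 } = ⊥-elim (d≢1 d≡1)
... | record { factors = p ∷ ps ; isFactorisation = d≡p*ps ; factorsPrime = pp ∷ _ } =
  p , pp , ℕ.divides (product ps) (trans d≡p*ps (ℕP.*-comm p (product ps)))

coprime-by-primes : ∀ {M s} → M ≢ 0 → (∀ {p} → Prime p → p ℕ.∣ M → ¬ (p ℕ.∣ s)) → Coprime M s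
coprime-by-primes {M} {s} M≢0 M⊥s {d} (d∣M , d∣s) with d ℕ.≟ 1
... | yes d≡1 = d≡1
... | no  d≢1 with prime-divisor (λ d≡0 → M≢0 (ℕ.0∣⇒≡0 (subst (ℕ._∣ M) d≡0 d∣M))) d≢1
...   | p , pp , p∣d = ⊥-elim (M⊥s pp (ℕ.∣-trans p∣d d∣M) (ℕ.∣-trans p∣d d∣s))

cancel-coprime : ∀ {m s D} j → m ≢ 0 → (∀ {p} → Prime p → p ℕ.∣ m → ¬ (+ p ∣ₛ s)) →
                 (+ m) ^ j ∣ₛ D * s → (+ m) ^ j ∣ D
cancel-coprime {m} {s} {D} j m≢0 m⊥s mʲ∣Ds =
  ℤ.coprime-divisor ((+ m) ^ j) s D mʲ⊥s (∣⇒∣ᵤ (subst ((+ m) ^ j ∣ₛ_) (ℤP.*-comm D s) mʲ∣Ds))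
  where
  mʲ≢0 : ∣ (+ m) ^ j ∣ ≢ 0
  mʲ≢0 e = m≢0 (cong ∣_∣ (ℤP.i^n≡0⇒i≡0 (+ m) j (ℤP.∣i∣≡0⇒i≡0 e)))
  mʲ⊥s : ℤ.Coprime ((+ m) ^ j) s
  mʲ⊥s = coprime-by-primes mʲ≢0 λ pp p∣mʲ p∣s →
    m⊥s pp (∣⇒∣ᵤ (prime∣^⇒∣ pp j (∣ᵤ⇒∣ p∣mʲ))) (∣ᵤ⇒∣ p∣s)

-- We cancel
-- from S the part sharing primes with m, which is at most one factor q.
module Descent (j : ℕ) {a b : ℤ} (a⊥b : NoCommonPrime a b) {m q : ℕ} (qp : Prime q) (m≢0 : m ≢ 0)
  (q-largest : ∀ {p} → Prime p → p ℕ.∣ m → p ≤ q)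
  (hyp : (+ (m ℕ.* q)) ^ suc j ∣ₛ a ^ (m ℕ.* q) - b ^ (m ℕ.* q)) where

  x y S : ℤ
  x = a ^ m
  y = b ^ m
  S = geom q x y

  Q : ℤ
  Q = + q

  x⊥y : NoCommonPrime x y
  x⊥y = NoCommonPrime-^ a⊥b m

  mq∣DS : (+ m) ^ suc j * Q ^ suc j ∣ₛ (x - y) * S
  mq∣DS = subst₂ _∣ₛ_ (trans (cong (_^ suc j) (ℤP.pos-* m q)) (^-distrib-* (+ m) Q (suc j)))
            (trans (cong₂ _-_ (sym (ℤP.^-*-assoc a m q)) (sym (ℤP.^-*-assoc b m q))) (geom-factor q x y))
            hyp

  small-prime∤S : ∀ {p} → Prime p → p ℕ.∣ m → p ≢ q → ¬ (+ p ∣ₛ S)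
  small-prime∤S pp p∣m p≢q = small-prime∤geom pp qp (ℕP.≤∧≢⇒< (q-largest pp p∣m) p≢q) x⊥y

  q∤m-case : ¬ (q ℕ.∣ m) → (+ m) ^ suc j ∣ x - y
  q∤m-case q∤m = cancel-coprime {s = S} {D = x - y} (suc j) m≢0 (λ pp p∣m → small-prime∤S pp p∣m (λ { refl → q∤m p∣m }))
                   (∣-trans (∣m⇒∣m*n (Q ^ suc j) ∣-refl) mq∣DS)

  -- If q ∣ m, then x ≡ y modulo q, so q divides S exactly once, and S / q
  -- shares no prime with m.
  q∣m-case : q ℕ.∣ m → (+ m) ^ suc j ∣ x - y
  q∣m-case q∣m = cancel-coprime {s = S′} {D = x - y} (suc j) m≢0 m⊥S′ mʲ⁺¹∣DS′
    where
    instance _ = prime⇒nonZero qp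
    q∣xᵠ-yᵠ : Q ∣ₛ x ^ q - y ^ q
    q∣xᵠ-yᵠ = subst (Q ∣ₛ_) (sym (geom-factor q x y))
                (∣-trans (∣n⇒∣m*n ((+ m) ^ suc j) (∣m⇒∣m*n (Q ^ j) ∣-refl)) mq∣DS)
    x≡y : x ≡ y mod Q
    x≡y = begin
      x      ≈⟨ mod-sym (fermat qp x) ⟩
      x ^ q  ≈⟨ congruent q∣xᵠ-yᵠ ⟩
      y ^ q  ≈⟨ fermat qp y ⟩
      y      ∎
      where open ModReasoning Q
    q∣S : Q ∣ₛ S
    q∣S = prime∣geom qp (proj₁ (congruent⇒∤ x⊥y qp x≡y)) x≡y
    S′ : ℤ
    S′ = quotient q∣S
    S≡S′q : S ≡ S′ * Q
    S≡S′q = _∣ₛ_.equality q∣S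
    q∤S′ : ¬ (Q ∣ₛ S′)
    q∤S′ (divides c S′≡cq) = lte qp q∣m x⊥y x≡y
      (divides c (trans S≡S′q (trans (cong (_* Q) S′≡cq) (ℤP.*-assoc c Q Q))))
    m⊥S′ : ∀ {p} → Prime p → p ℕ.∣ m → ¬ (+ p ∣ₛ S′)
    m⊥S′ {p} pp p∣m p∣S′ = by-cases (p ℕ.≟ q)
      where
      by-cases : Dec (p ≡ q) → ⊥
      by-cases (yes p≡q) = q∤S′ (subst (λ r → + r ∣ₛ S′) p≡q p∣S′)
      by-cases (no  p≢q) = small-prime∤S pp p∣m p≢q (subst (+ p ∣ₛ_) (sym S≡S′q) (∣m⇒∣m*n Q p∣S′))
    mʲ⁺¹qʲq∣DS′q : (+ m) ^ suc j * Q ^ j * Q ∣ₛ (x - y) * S′ * Q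
    mʲ⁺¹qʲq∣DS′q = subst₂ _∣ₛ_ (lem₁ ((+ m) ^ suc j) Q (Q ^ j))
                     (trans (cong ((x - y) *_) S≡S′q) (lem₂ (x - y) S′ Q)) mq∣DS
      where
      lem₁ : ∀ M Q R → M * (Q * R) ≡ M * R * Q
      lem₁ = solve-∀
      lem₂ : ∀ D S Q → D * (S * Q) ≡ D * S * Q
      lem₂ = solve-∀
    mʲ⁺¹∣DS′ : (+ m) ^ suc j ∣ₛ (x - y) * S′
    mʲ⁺¹∣DS′ = ∣-trans (∣m⇒∣m*n {m = (+ m) ^ suc j} (Q ^ j) ∣-refl)
                 (*-cancelʳ-∣ Q {(+ m) ^ suc j * Q ^ j} {(x - y) * S′} mʲ⁺¹qʲq∣DS′q)

  result : (+ m) ^ suc j ∣ x - y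
  result with q ℕ.∣? m
  ... | yes q∣m = q∣m-case q∣m
  ... | no  q∤m = q∤m-case q∤m

gcd≡1⇒NoCommonPrime : ∀ {a b} → gcd a b ≡ + 1 → NoCommonPrime a b
gcd≡1⇒NoCommonPrime {a} {b} gcd≡1 {p} pp p∣a p∣b =
  prime∤1 pp (∣ᵤ⇒∣ (subst (+ p ∣_) gcd≡1 (gcd-greatest {a} {b} {+ p} (∣⇒∣ᵤ p∣a) (∣⇒∣ᵤ p∣b))))

proposition2 : (j : ℕ) → 1 ≤ j → (a b : ℤ) → gcd a b ≡ + 1 →
    (n : ℕ) → 1 < n → (+ n) ^ j ∣ a ^ n - b ^ n →
    (q : ℕ) .{{_ : NonZero q}} → IsLargestPrimeFactor q n →
    (+ (n / q)) ^ j ∣ a ^ (n / q) - b ^ (n / q)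
proposition2 zero    () a b gcd≡1 n 1<n nʲ∣aⁿ-bⁿ q lpf
proposition2 (suc j) _  a b gcd≡1 n 1<n nʲ∣aⁿ-bⁿ q (qp , ℕ.divides m n≡mq , q-largest) =
  subst (λ k → (+ k) ^ suc j ∣ a ^ k - b ^ k) (sym n/q≡m)
    (Descent.result j (gcd≡1⇒NoCommonPrime gcd≡1) qp m≢0 q-largest-in-m (∣ᵤ⇒∣ mqʲ∣aᵐᵠ-bᵐᵠ))
  where
  n/q≡m : n / q ≡ m
  n/q≡m = trans (cong (_/ q) n≡mq) (m*n/n≡m m q)
  m≢0 : m ≢ 0
  m≢0 refl = ℕP.n≮0 (subst (1 <_) n≡mq 1<n)
  q-largest-in-m : ∀ {p} → Prime p → p ℕ.∣ m → p ≤ q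
  q-largest-in-m pp p∣m = q-largest _ pp (ℕ.∣-trans p∣m (ℕ.divides q (trans n≡mq (ℕP.*-comm m q))))
  mqʲ∣aᵐᵠ-bᵐᵠ : (+ (m ℕ.* q)) ^ suc j ∣ a ^ (m ℕ.* q) - b ^ (m ℕ.* q)
  mqʲ∣aᵐᵠ-bᵐᵠ = subst (λ k → (+ k) ^ suc j ∣ a ^ k - b ^ k) n≡mq nʲ∣aⁿ-bⁿ
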